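{- Let $V$ be a finite non-empty set and $T:\mathscr{P}(V)\to\mathscr{P}(V)$ a map. Suppose $(E_1,E_2)$ is the unique pair of equivalence relations on $V$ with $T(X)=\mathbf{l}_{E_2}(\mathbf{l}_{E_1}(X))$ for all $X\subseteq V$, where $E_1$ has $m$ classes and $E_2$ has $n$ classes. Let $S_1$ (resp. $S_2$) be the number of singleton equivalence classes of $E_1$ (resp. $E_2$). Then $S_1\le n$ and $S_2\le m$.
   Context: For an equivalence relation $E$ on $V$: $\mathbf{l}_E(X)=\{x\in V:[x]_E\subseteq X\}$. -}

module Defs where

open import Data.Nat using (ℕ; zero; suc; _+_; _<ᵇ_; _≡ᵇ_)
open import Data.Bool using (Bool; true; false; not; _∧_; _∨_; if_then_else_)
open import Data.Fin using (Fin; zero; suc; toℕ)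
open import Data.Fin.Subset using (Subset)
open import Data.Vec using (tabulate; lookup)
open import Relation.Binary.PropositionalEquality using (_≡_)

allB : ∀ {k} → (Fin k → Bool) → Bool
allB {zero}  f = true
allB {suc k} f = f zero ∧ allB (λ i → f (suc i))

countB : ∀ {k} → (Fin k → Bool) → ℕ
countB {zero}  f = 0
countB {suc k} f = (if f zero then 1 else 0) + countB (λ i → f (suc i))

-- An equivalence relation on the finite set Fin k (given by its
-- characteristic function; every relation on a finite set is decidable).
record EqRel (k : ℕ) : Set where
  field
    rel    : Fin k → Fin k → Bool
    reflE  : ∀ x → rel x x ≡ true
    symE   : ∀ x y → rel x y ≡ true → rel y x ≡ true
    transE : ∀ x y z → rel x y ≡ true → rel y z ≡ true → rel x z ≡ true
open EqRel public

lower : ∀ {k} → EqRel k → Subset k → Subset k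
lower E X = tabulate (λ x → allB (λ y → not (rel E x y) ∨ lookup X y))

-- number of equivalence classes: count elements that are the least
-- (w.r.t. the order of Fin k) element of their class
numClasses : ∀ {k} → EqRel k → ℕ
numClasses E = countB (λ x → allB (λ y → not ((toℕ y <ᵇ toℕ x) ∧ rel E x y)))

numSingletons : ∀ {k} → EqRel k → ℕ
numSingletons E = countB (λ x → allB (λ y → not (rel E x y) ∨ (toℕ y ≡ᵇ toℕ x)))

-- If two distinct singleton classes {a} and {b} of E₁ were E₂-related, merging them
-- into one E₁-class would not change the composite relation E₂ ⨾ E₁ (whatever is
-- reached through a is reached through b anyway), and x ∈ l_{E₂}(l_{E₁}(X)) depends
-- only on that composite; this contradicts uniqueness. Hence distinct singletons of
-- E₁ lie in distinct E₂-classes, i.e. sending a singleton to the least element of its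
-- E₂-class is injective, so S₁ ≤ n. Merging two E₁-related singletons of E₂
-- gives S₂ ≤ m in the same way.
module Submission where

open import Defs
open import Data.Bool using (Bool; true; false; not; _∧_; _∨_; if_then_else_; T; T?)
open import Data.Bool.Properties using (T-≡; T-not-≡; T-∧; T-∨; ∧-zeroʳ; ∧-identityʳ)
open import Data.Empty using (⊥-elim)
open import Data.Fin using (Fin; zero; suc; toℕ; _≟_; _<_)
open import Data.Fin.Induction using (<-wellFounded)
open import Data.Fin.Properties using (toℕ-injective; suc-injective)
open import Data.Fin.Subset using (Subset)
open import Data.Nat using (ℕ; suc; _+_; _≤_; z≤n; s≤s; _<ᵇ_; _≡ᵇ_)
open import Data.Nat.Properties using (≡ᵇ⇒≡; <ᵇ⇒<; +-suc)
open import Data.Product using (_×_; _,_; proj₁; proj₂; ∃-syntax)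
import Data.Product as Product
open import Data.Sum using (_⊎_; inj₁; inj₂)
import Data.Sum as Sum
open import Data.Unit using (tt)
open import Data.Vec using (lookup; tabulate)
open import Data.Vec.Properties using (lookup∘tabulate; tabulate∘lookup; tabulate-cong)
open import Function using (_∘_; id; case_of_)
open import Function.Bundles using (_⇔_; mk⇔; Equivalence)
open import Induction.WellFounded using (Acc; acc)
open import Relation.Binary.PropositionalEquality
  using (_≡_; refl; sym; trans; cong; cong₂; subst; module ≡-Reasoning)
open import Relation.Nullary using (¬_; Dec; does; yes; no)
open import Relation.Nullary.Decidable using (dec-false)

open Equivalence using (to; from)

T-extensional : ∀ {a b} → (T a → T b) → (T b → T a) → a ≡ b
T-extensional {false} {false} _ _ = refl
T-extensional {false} {true}  _ g = ⊥-elim (g tt)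
T-extensional {true}  {false} f _ = ⊥-elim (f tt)
T-extensional {true}  {true}  _ _ = refl

¬T-not : ∀ {b} → ¬ T (not b) → T b
¬T-not {false} ¬t = ¬t tt
¬T-not {true}  _  = tt

T-not∨ : ∀ {b c} → T (not b ∨ c) ⇔ (T b → T c)
T-not∨ {false} = mk⇔ (λ _ ()) (λ _ → tt)
T-not∨ {true}  = mk⇔ (λ c _ → c) (λ f → f tt)

T-does : ∀ {A : Set} (a? : Dec A) → T (does a?) ⇔ A
T-does (yes a) = mk⇔ (λ _ → a) (λ _ → tt)
T-does (no ¬a) = mk⇔ (λ ()) ¬a

T-allB : ∀ {k} {f : Fin k → Bool} → T (allB f) ⇔ (∀ i → T (f i))
T-allB = mk⇔ sound complete
  where
  sound : ∀ {k} {f : Fin k → Bool} → T (allB f) → ∀ i → T (f i)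
  sound {suc k} {f} all zero    = proj₁ (to T-∧ all)
  sound {suc k} {f} all (suc i) = sound {k} (proj₂ (to T-∧ all)) i
  complete : ∀ {k} {f : Fin k → Bool} → (∀ i → T (f i)) → T (allB f)
  complete {ℕ.zero} _   = tt
  complete {suc k}  all = from T-∧ (all zero , complete {k} (all ∘ suc))

allB-counterexample : ∀ {k} (f : Fin k → Bool) → ¬ T (allB f) → ∃[ i ] ¬ T (f i)
allB-counterexample {ℕ.zero} f ¬all = ⊥-elim (¬all tt)
allB-counterexample {suc k}  f ¬all with f zero in eq
... | false = zero , subst T eq
... | true  with i , ¬fi ← allB-counterexample (f ∘ suc) ¬all = suc i , ¬fi

countB-cong : ∀ {k} {P Q : Fin k → Bool} → (∀ i → P i ≡ Q i) → countB P ≡ countB Q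
countB-cong {ℕ.zero} _   = refl
countB-cong {suc k}  P≡Q =
  cong₂ (λ b n → (if b then 1 else 0) + n) (P≡Q zero) (countB-cong (P≡Q ∘ suc))

countB-remove : ∀ {n} (Q : Fin n → Bool) {c : Fin n} → T (Q c)
  → countB Q ≡ suc (countB (λ y → Q y ∧ not (does (y ≟ c))))
countB-remove {suc n} Q {zero} Qc = begin
  (if Q zero then 1 else 0) + countB (Q ∘ suc)
    ≡⟨ cong (λ b → (if b then 1 else 0) + countB (Q ∘ suc)) (to T-≡ Qc) ⟩
  suc (countB (Q ∘ suc))
    ≡⟨ cong₂ (λ b m → suc ((if b then 1 else 0) + m))
         (sym (∧-zeroʳ (Q zero))) (countB-cong (sym ∘ ∧-identityʳ ∘ Q ∘ suc)) ⟩
  suc (countB (λ y → Q y ∧ not (does (y ≟ zero)))) ∎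
  where open ≡-Reasoning
countB-remove {suc n} Q {suc c} Qc = begin
  (if Q zero then 1 else 0) + countB (Q ∘ suc)
    ≡⟨ cong₂ (λ b m → (if b then 1 else 0) + m)
         (sym (∧-identityʳ (Q zero))) (countB-remove (Q ∘ suc) Qc) ⟩
  (if Q zero ∧ true then 1 else 0) + suc (countB (λ y → Q (suc y) ∧ not (does (y ≟ c))))
    ≡⟨ +-suc _ _ ⟩
  suc (countB (λ y → Q y ∧ not (does (y ≟ suc c)))) ∎
  where open ≡-Reasoning

countB-≤-injection : ∀ {m n} (P : Fin m → Bool) (Q : Fin n → Bool) (f : Fin m → Fin n)
  → (∀ {x} → T (P x) → T (Q (f x)))
  → (∀ {x y} → T (P x) → T (P y) → f x ≡ f y → x ≡ y)
  → countB P ≤ countB Q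
countB-≤-injection {ℕ.zero} P Q f _ _ = z≤n
-- By injectivity the other P-elements avoid f zero, so f zero can be removed from Q.
countB-≤-injection {suc m}  P Q f maps inj with P zero in eq
... | false = countB-≤-injection (P ∘ suc) Q (f ∘ suc) maps (λ Px Py → suc-injective ∘ inj Px Py)
... | true  = subst (suc (countB (P ∘ suc)) ≤_) (sym (countB-remove Q (maps P0)))
  (s≤s (countB-≤-injection (P ∘ suc) _ (f ∘ suc) maps′ (λ Px Py → suc-injective ∘ inj Px Py)))
  where
  P0 : T (P zero)
  P0 = subst T (sym eq) tt
  maps′ : ∀ {x} → T (P (suc x)) → T (Q (f (suc x)) ∧ not (does (f (suc x) ≟ f zero)))
  maps′ {x} Px = from T-∧
    (maps Px , from T-not-≡ (dec-false (f (suc x) ≟ f zero) (λ fx≡f0 → case inj Px P0 fx≡f0 of λ ())))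

module _ {k : ℕ} where

  infix 4 _∼[_]_

  _∼[_]_ : Fin k → EqRel k → Fin k → Set
  x ∼[ E ] y = T (rel E x y)

  ∼-refl : ∀ (E : EqRel k) {x} → x ∼[ E ] x
  ∼-refl E {x} = from T-≡ (reflE E x)

  ∼-sym : ∀ (E : EqRel k) {x y} → x ∼[ E ] y → y ∼[ E ] x
  ∼-sym E {x} {y} = from T-≡ ∘ symE E x y ∘ to T-≡

  ∼-trans : ∀ (E : EqRel k) {x y z} → x ∼[ E ] y → y ∼[ E ] z → x ∼[ E ] z
  ∼-trans E {x} {y} {z} x∼y y∼z = from T-≡ (transE E x y z (to T-≡ x∼y) (to T-≡ y∼z))

  mkEqRel : (R : Fin k → Fin k → Bool)
    → (∀ {x} → T (R x x)) → (∀ {x y} → T (R x y) → T (R y x))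
    → (∀ {x y z} → T (R x y) → T (R y z) → T (R x z))
    → EqRel k
  mkEqRel R r s t = record
    { rel    = R
    ; reflE  = λ _ → to T-≡ r
    ; symE   = λ _ _ → to T-≡ ∘ s ∘ from T-≡
    ; transE = λ _ _ _ xy yz → to T-≡ (t (from T-≡ xy) (from T-≡ yz))
    }

  IsSingleton : EqRel k → Fin k → Set
  IsSingleton E a = ∀ {y} → a ∼[ E ] y → y ≡ a

  isSingletonᵇ : EqRel k → Fin k → Bool
  isSingletonᵇ E x = allB (λ y → not (rel E x y) ∨ (toℕ y ≡ᵇ toℕ x))

  isSingletonᵇ-sound : ∀ (E : EqRel k) {x} → T (isSingletonᵇ E x) → IsSingleton E x
  isSingletonᵇ-sound E {x} single {y} x∼y =
    toℕ-injective (≡ᵇ⇒≡ (toℕ y) (toℕ x) (to T-not∨ (to T-allB single y) x∼y))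

  isLeastᵇ : EqRel k → Fin k → Bool
  isLeastᵇ E x = allB (λ y → not ((toℕ y <ᵇ toℕ x) ∧ rel E x y))

  least-representative : ∀ (E : EqRel k) x → ∃[ r ] T (isLeastᵇ E r) × x ∼[ E ] r
  least-representative E x = go x (<-wellFounded x)
    where
    go : ∀ x → Acc _<_ x → ∃[ r ] T (isLeastᵇ E r) × x ∼[ E ] r
    go x (acc smaller) with T? (isLeastᵇ E x)
    ... | yes least = x , least , ∼-refl E
    ... | no ¬least with y , ¬y≺x ← allB-counterexample _ ¬least =
      let y<x , x∼y = to T-∧ (¬T-not ¬y≺x)
          r , least , y∼r = go y (smaller (<ᵇ⇒< (toℕ y) (toℕ x) y<x))
      in r , least , ∼-trans E x∼y y∼r

  singletons-≤-classes : ∀ (E F : EqRel k)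
    → (∀ {a b} → IsSingleton E a → IsSingleton E b → a ∼[ F ] b → a ≡ b)
    → numSingletons E ≤ numClasses F
  singletons-≤-classes E F separated =
    countB-≤-injection (isSingletonᵇ E) (isLeastᵇ F) representative
      (λ {x} _ → proj₁ (proj₂ (least-representative F x))) injective
    where
    representative : Fin k → Fin k
    representative x = proj₁ (least-representative F x)
    ∼representative : ∀ x → x ∼[ F ] representative x
    ∼representative x = proj₂ (proj₂ (least-representative F x))
    injective : ∀ {x y} → T (isSingletonᵇ E x) → T (isSingletonᵇ E y)
      → representative x ≡ representative y → x ≡ y
    injective {x} {y} x-single y-single same =
      separated (isSingletonᵇ-sound E x-single) (isSingletonᵇ-sound E y-single)
        (∼-trans F (∼representative x)
          (subst (_∼[ F ] y) (sym same) (∼-sym F (∼representative y))))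

  subset-ext : ∀ {A B : Subset k} → (∀ x → T (lookup A x) ⇔ T (lookup B x)) → A ≡ B
  subset-ext {A} {B} A⇔B = begin
    A                    ≡⟨ sym (tabulate∘lookup A) ⟩
    tabulate (lookup A)  ≡⟨ tabulate-cong (λ x → T-extensional (to (A⇔B x)) (from (A⇔B x))) ⟩
    tabulate (lookup B)  ≡⟨ tabulate∘lookup B ⟩
    B                    ∎
    where open ≡-Reasoning

  T-lower : ∀ (E : EqRel k) (X : Subset k) {x}
    → T (lookup (lower E X) x) ⇔ (∀ {y} → x ∼[ E ] y → T (lookup X y))
  T-lower E X {x} rewrite lookup∘tabulate (λ x → allB (λ y → not (rel E x y) ∨ lookup X y)) x =
    mk⇔ (λ mem {y} → to T-not∨ (to T-allB mem y)) (λ sub → from T-allB (λ y → from T-not∨ (sub {y})))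

  _⨾_ : EqRel k → EqRel k → Fin k → Fin k → Set
  (E₂ ⨾ E₁) x z = ∃[ y ] x ∼[ E₂ ] y × y ∼[ E₁ ] z

  T-lower∘lower : ∀ (E₁ E₂ : EqRel k) (X : Subset k) {x}
    → T (lookup (lower E₂ (lower E₁ X)) x) ⇔ (∀ {z} → (E₂ ⨾ E₁) x z → T (lookup X z))
  T-lower∘lower E₁ E₂ X = mk⇔
    (λ mem {z} (y , x∼y , y∼z) → to (T-lower E₁ X) (to (T-lower E₂ (lower E₁ X)) mem x∼y) y∼z)
    (λ sub → from (T-lower E₂ (lower E₁ X)) λ {y} x∼y → from (T-lower E₁ X) λ y∼z → sub (y , x∼y , y∼z))

  lower∘lower-cong : ∀ {E₁ E₂ F₁ F₂ : EqRel k}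
    → (∀ {x z} → (E₂ ⨾ E₁) x z → (F₂ ⨾ F₁) x z) → (∀ {x z} → (F₂ ⨾ F₁) x z → (E₂ ⨾ E₁) x z)
    → ∀ X → lower E₂ (lower E₁ X) ≡ lower F₂ (lower F₁ X)
  lower∘lower-cong {E₁} {E₂} {F₁} {F₂} E⊆F F⊆E X = subset-ext λ x → mk⇔
    (λ mem → from (T-lower∘lower F₁ F₂ X) (λ c → to (T-lower∘lower E₁ E₂ X) mem (F⊆E c)))
    (λ mem → from (T-lower∘lower E₁ E₂ X) (λ c → to (T-lower∘lower F₁ F₂ X) mem (E⊆F c)))

  ⨾-mono : ∀ {E₁ E₂ F₁ F₂ : EqRel k}
    → (∀ {x y} → x ∼[ E₂ ] y → x ∼[ F₂ ] y) → (∀ {x y} → x ∼[ E₁ ] y → x ∼[ F₁ ] y)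
    → ∀ {x z} → (E₂ ⨾ E₁) x z → (F₂ ⨾ F₁) x z
  ⨾-mono E₂⊆F₂ E₁⊆F₁ (y , x∼y , y∼z) = y , E₂⊆F₂ x∼y , E₁⊆F₁ y∼z

  OneOf : Fin k → Fin k → Fin k → Set
  OneOf a b x = x ≡ a ⊎ x ≡ b

  oneOfᵇ : Fin k → Fin k → Fin k → Bool
  oneOfᵇ a b x = does (x ≟ a) ∨ does (x ≟ b)

  T-oneOfᵇ : ∀ {a b x} → T (oneOfᵇ a b x) ⇔ OneOf a b x
  T-oneOfᵇ {a} {b} {x} = mk⇔
    (Sum.map (to (T-does (x ≟ a))) (to (T-does (x ≟ b))) ∘ to T-∨)
    (from T-∨ ∘ Sum.map (from (T-does (x ≟ a))) (from (T-does (x ≟ b))))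

  pair-related : ∀ (E : EqRel k) {a b} → a ∼[ E ] b
    → ∀ {x y} → OneOf a b x → OneOf a b y → x ∼[ E ] y
  pair-related E a∼b (inj₁ refl) (inj₁ refl) = ∼-refl E
  pair-related E a∼b (inj₁ refl) (inj₂ refl) = a∼b
  pair-related E a∼b (inj₂ refl) (inj₁ refl) = ∼-sym E a∼b
  pair-related E a∼b (inj₂ refl) (inj₂ refl) = ∼-refl E

  module Merge (E : EqRel k) {a b : Fin k} (a-single : IsSingleton E a) (b-single : IsSingleton E b) where

    Merged : Fin k → Fin k → Set
    Merged x y = x ∼[ E ] y ⊎ OneOf a b x × OneOf a b y

    mergedᵇ : Fin k → Fin k → Bool
    mergedᵇ x y = rel E x y ∨ (oneOfᵇ a b x ∧ oneOfᵇ a b y)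

    T-mergedᵇ : ∀ {x y} → T (mergedᵇ x y) ⇔ Merged x y
    T-mergedᵇ = mk⇔
      (Sum.map₂ (Product.map (to T-oneOfᵇ) (to T-oneOfᵇ) ∘ to T-∧) ∘ to T-∨)
      (from T-∨ ∘ Sum.map₂ (from T-∧ ∘ Product.map (from T-oneOfᵇ) (from T-oneOfᵇ)))

    oneOf-singleton : ∀ {y w} → OneOf a b y → y ∼[ E ] w → w ≡ y
    oneOf-singleton (inj₁ refl) = a-single
    oneOf-singleton (inj₂ refl) = b-single

    Merged-sym : ∀ {x y} → Merged x y → Merged y x
    Merged-sym (inj₁ x∼y)      = inj₁ (∼-sym E x∼y)
    Merged-sym (inj₂ (ox , oy)) = inj₂ (oy , ox)

    Merged-trans : ∀ {x y z} → Merged x y → Merged y z → Merged x z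
    Merged-trans (inj₁ x∼y)      (inj₁ y∼z)       = inj₁ (∼-trans E x∼y y∼z)
    Merged-trans (inj₁ x∼y)      (inj₂ (oy , oz)) =
      inj₂ (subst (OneOf a b) (sym (oneOf-singleton oy (∼-sym E x∼y))) oy , oz)
    Merged-trans (inj₂ (ox , oy)) (inj₁ y∼z)       =
      inj₂ (ox , subst (OneOf a b) (sym (oneOf-singleton oy y∼z)) oy)
    Merged-trans (inj₂ (ox , _))  (inj₂ (_ , oz))  = inj₂ (ox , oz)

    merged : EqRel k
    merged = mkEqRel mergedᵇ
      (from T-mergedᵇ (inj₁ (∼-refl E)))
      (from T-mergedᵇ ∘ Merged-sym ∘ to T-mergedᵇ)
      (λ xy yz → from T-mergedᵇ (Merged-trans (to T-mergedᵇ xy) (to T-mergedᵇ yz)))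

    ∼⇒∼merged : ∀ {x y} → x ∼[ E ] y → x ∼[ merged ] y
    ∼⇒∼merged = from T-mergedᵇ ∘ inj₁

    merged-unchanged⇒≡ : (∀ x y → rel merged x y ≡ rel E x y) → a ≡ b
    merged-unchanged⇒≡ unchanged =
      sym (a-single (subst T (unchanged a b) (from T-mergedᵇ (inj₂ (inj₁ refl , inj₂ refl)))))

    ⨾merged⊆ : ∀ (F : EqRel k) → a ∼[ F ] b → ∀ {x z} → (F ⨾ merged) x z → (F ⨾ E) x z
    ⨾merged⊆ F a∼b (y , x∼y , y≈z) with to T-mergedᵇ y≈z
    ... | inj₁ y∼z       = y , x∼y , y∼z
    ... | inj₂ (oy , oz) = _ , ∼-trans F x∼y (pair-related F a∼b oy oz) , ∼-refl E

    merged⨾⊆ : ∀ (F : EqRel k) → a ∼[ F ] b → ∀ {x z} → (merged ⨾ F) x z → (E ⨾ F) x z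
    merged⨾⊆ F a∼b (y , x≈y , y∼z) with to T-mergedᵇ x≈y
    ... | inj₁ x∼y       = y , x∼y , y∼z
    ... | inj₂ (ox , oy) = _ , ∼-refl E , ∼-trans F (pair-related F a∼b ox oy) y∼z

    lower∘lower-merged : ∀ (F : EqRel k) → a ∼[ F ] b
      → ∀ X → lower F (lower E X) ≡ lower F (lower merged X)
    lower∘lower-merged F a∼b = lower∘lower-cong {E} {F} {merged} {F}
      (⨾-mono {E} {F} {merged} {F} id ∼⇒∼merged) (⨾merged⊆ F a∼b)

    lower-merged∘lower : ∀ (F : EqRel k) → a ∼[ F ] b
      → ∀ X → lower E (lower F X) ≡ lower merged (lower F X)
    lower-merged∘lower F a∼b = lower∘lower-cong {F} {E} {F} {merged}
      (⨾-mono {F} {E} {F} {merged} ∼⇒∼merged id) (merged⨾⊆ F a∼b)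

  Represents : (Subset k → Subset k) → EqRel k → EqRel k → Set
  Represents Φ E₁ E₂ = ∀ X → Φ X ≡ lower E₂ (lower E₁ X)

  UniquelyRepresents : (Subset k → Subset k) → EqRel k → EqRel k → Set
  UniquelyRepresents Φ E₁ E₂ = ∀ F₁ F₂ → Represents Φ F₁ F₂
    → (∀ x y → rel F₁ x y ≡ rel E₁ x y) × (∀ x y → rel F₂ x y ≡ rel E₂ x y)

  module _ {Φ : Subset k → Subset k} (E₁ E₂ : EqRel k)
    (represents : Represents Φ E₁ E₂) (unique : UniquelyRepresents Φ E₁ E₂) where

    singletons₁-separated : ∀ {a b} → IsSingleton E₁ a → IsSingleton E₁ b → a ∼[ E₂ ] b → a ≡ b
    singletons₁-separated a-single b-single a∼b =
      merged-unchanged⇒≡ (proj₁ (unique merged E₂ represents-merged))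
      where
      open Merge E₁ a-single b-single
      represents-merged : Represents Φ merged E₂
      represents-merged X = trans (represents X) (lower∘lower-merged E₂ a∼b X)

    singletons₂-separated : ∀ {a b} → IsSingleton E₂ a → IsSingleton E₂ b → a ∼[ E₁ ] b → a ≡ b
    singletons₂-separated a-single b-single a∼b =
      merged-unchanged⇒≡ (proj₂ (unique E₁ merged represents-merged))
      where
      open Merge E₂ a-single b-single
      represents-merged : Represents Φ E₁ merged
      represents-merged X = trans (represents X) (lower-merged∘lower E₁ a∼b X)

mainTheorem10 : (k : ℕ) (T : Subset (suc k) → Subset (suc k)) (E₁ E₂ : EqRel (suc k))
    → (∀ X → T X ≡ lower E₂ (lower E₁ X))
    → (∀ (F₁ F₂ : EqRel (suc k)) → (∀ X → T X ≡ lower F₂ (lower F₁ X))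
        → (∀ x y → rel F₁ x y ≡ rel E₁ x y) × (∀ x y → rel F₂ x y ≡ rel E₂ x y))
    → (numSingletons E₁ ≤ numClasses E₂) × (numSingletons E₂ ≤ numClasses E₁)
mainTheorem10 k T E₁ E₂ represents unique =
  singletons-≤-classes E₁ E₂ (singletons₁-separated E₁ E₂ represents unique) ,
  singletons-≤-classes E₂ E₁ (singletons₂-separated E₁ E₂ represents unique)
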